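{- Let $\mathcal H$ be an $(r,t)$-graph with maximum vertex degree $\Delta$ and minimum vertex degree $\delta\ge 1$. Then \[ \tau(\mathcal H)\le \left(\frac{\Delta-1}{\delta}\right)\frac rt - \frac{\Delta-\delta-1}{\delta}. \]
   Context: All hypergraphs are finite. An $r$-uniform hypergraph $\mathcal H$ is $r$-partite if its vertex set can be partitioned as $V(\mathcal H)=P_1\sqcup\dots\sqcup P_r$ such that $|e\cap P_j|=1$ for every edge $e$ and every $j\in[r]$. It is $t$-intersecting if $|e\cap f|\ge t$ for all $e,f\in E(\mathcal H)$. An $(r,t)$-graph is an $r$-uniform, $r$-partite, $t$-intersecting hypergraph. The degree of a vertex is the number of edges containing it. A cover of $\mathcal H$ is a set $C\subseteq V(\mathcal H)$ with $C\cap e\neq\emptyset$ for every edge $e$; the cover number $\tau(\mathcal H)$ is the minimum size of a cover. -}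

module Defs where

open import Data.Nat using (ℕ; _≤_; _≥_)
open import Data.Fin using (Fin)
open import Data.Fin.Subset using (Subset; _∈_; _∩_; ∣_∣)
open import Data.Fin.Subset.Properties using (_∈?_)
open import Data.List using (List; length; filter)
open import Data.List.Membership.Propositional renaming (_∈_ to _∈ₗ_)
open import Data.List.Relation.Unary.Unique.Propositional using (Unique)
open import Data.Product using (Σ; _×_; ∃-syntax)
open import Relation.Binary.PropositionalEquality using (_≡_)

-- A finite hypergraph on vertex set Fin n; edges form a set (a duplicate-free
-- list of subsets of the vertex set).
record Hypergraph (n : ℕ) : Set where
  field
    edges  : List (Subset n)
    unique : Unique edges
open Hypergraph public

degree : ∀ {n} → Hypergraph n → Fin n → ℕ
degree H v = length (filter (v ∈?_) (edges H))

Uniform : ∀ {n} → ℕ → Hypergraph n → Set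
Uniform r H = ∀ e → e ∈ₗ edges H → ∣ e ∣ ≡ r

-- r-partite: a partition V = P_1 ⊔ … ⊔ P_r (given by a part-assignment map)
-- such that every edge meets every part in exactly one vertex.
partOf : ∀ {n r} → (Fin n → Fin r) → Fin r → Subset n
partOf {n} p j = Data.Vec.tabulate (λ v → isYes (p v Data.Fin.≟ j))
  where open import Data.Vec
        open import Relation.Nullary.Decidable using (isYes)
        import Data.Fin

Partite : ∀ {n} → ℕ → Hypergraph n → Set
Partite {n} r H = Σ (Fin n → Fin r) λ p →
  ∀ e → e ∈ₗ edges H → ∀ j → ∣ e ∩ partOf p j ∣ ≡ 1

Intersecting : ∀ {n} → ℕ → Hypergraph n → Set
Intersecting t H = ∀ e f → e ∈ₗ edges H → f ∈ₗ edges H → ∣ e ∩ f ∣ ≥ t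

IsRTGraph : ∀ {n} → ℕ → ℕ → Hypergraph n → Set
IsRTGraph r t H = Uniform r H × Partite r H × Intersecting t H

MaxDegree : ∀ {n} → Hypergraph n → ℕ → Set
MaxDegree H Δ = (∃[ v ] degree H v ≡ Δ) × (∀ v → degree H v ≤ Δ)

MinDegree : ∀ {n} → Hypergraph n → ℕ → Set
MinDegree H δ = (∃[ v ] degree H v ≡ δ) × (∀ v → δ ≤ degree H v)

IsCover : ∀ {n} → Hypergraph n → Subset n → Set
IsCover H C = ∀ e → e ∈ₗ edges H → ∃[ v ] (v ∈ C × v ∈ e)

IsCoverNumber : ∀ {n} → Hypergraph n → ℕ → Set
IsCoverNumber H m = (∃[ C ] (IsCover H C × ∣ C ∣ ≡ m))
                  × (∀ C → IsCover H C → m ≤ ∣ C ∣)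

module Submission where

open import Defs

-- Let x be a vertex of maximum degree Δ and P the part of the r-partition that
-- contains x.  Every edge meets P in exactly one vertex, so P is a cover and
-- τ ≤ |P|.  Two double countings of vertex–edge incidences, with m = |E(H)|:
--   (1) Σ_{v ∈ P} deg v = m, and the degrees are ≥ δ except deg x = Δ, so
--       |P|·δ + Δ ≤ m + δ;
--   (2) for an edge e, Σ_{v ∈ e} deg v = Σ_f |f ∩ e| ≥ r + t·(m - 1) since e meets
--       itself in r vertices and every other edge in ≥ t, while the left side is
--       ≤ r·Δ; so r + t·m ≤ r·Δ + t.
-- Eliminating m gives t·δ·τ + t·Δ + r ≤ r·Δ + t + t·δ, which rearranges to the
-- rational bound.

module Counting where
  open import Data.Bool using (true; false; if_then_else_)
  open import Data.Fin using (Fin; zero; suc; punchIn; _≟_)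
  open import Data.Fin.Subset using (Subset; _∩_; ∣_∣; Nonempty; inside; outside) renaming (_∈_ to _∈ₛ_)
  open import Data.Fin.Subset.Properties using (_∈?_; x∈p∩q⁻; nonempty?; Empty-unique; ∣⊥∣≡0; ∩-idem)
  open import Data.List using (List; []; _∷_; length; filter; map)
  open import Data.List.Membership.Propositional using (_∈_)
  open import Data.List.Relation.Unary.Any using (here; there)
  open import Data.Nat using (ℕ; zero; suc; _+_; _*_; _≤_; _<_; z≤n)
  open import Data.Nat.ListAction using () renaming (sum to sumₗ)
  open import Data.Nat.Properties hiding (_≟_)
  open import Data.Nat.Tactic.RingSolver using (solve-∀)
  open import Data.Product using (_,_; ∃-syntax)
  open import Data.Vec using ([]; _∷_)
  open import Data.Vec.Functional using (removeAt)
  open import Data.Vec.Properties using (lookup⇒[]=; lookup∘tabulate)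
  open import Relation.Binary.PropositionalEquality
  open import Relation.Nullary using (yes; no; does; contradiction)
  open import Relation.Nullary.Decidable using (isYes≗does; dec-true)
  open import Algebra.Properties.Semiring.Sum +-*-semiring
    using (sum; sum-remove; sum-cong-≗; sum-replicate-zero; ∑-distrib-+; *-distribʳ-sum)
  open import Algebra.Properties.CommutativeSemigroup +-commutativeSemigroup using (x∙yz≈y∙xz; x∙yz≈zy∙x)

  private
    variable
      n : ℕ

  sum-mono : ∀ {n} {g h : Fin n → ℕ} → (∀ v → g v ≤ h v) → sum g ≤ sum h
  sum-mono {zero}  g≤h = z≤n
  sum-mono {suc n} g≤h = +-mono-≤ (g≤h zero) (sum-mono (λ v → g≤h (suc v)))

  sum-exchange : ∀ {n} {g h : Fin n → ℕ} → (∀ v → g v ≤ h v) → ∀ x → sum g + h x ≤ sum h + g x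
  sum-exchange {suc n} {g} {h} g≤h x = begin
    sum g + h x                    ≡⟨ cong (_+ h x) (sum-remove {i = x} g) ⟩
    g x + sum-g′ + h x             ≤⟨ +-monoˡ-≤ (h x) (+-monoʳ-≤ (g x) (sum-mono (λ v → g≤h (punchIn x v)))) ⟩
    g x + sum-h′ + h x             ≡⟨ trans (+-assoc (g x) sum-h′ (h x)) (x∙yz≈zy∙x (g x) sum-h′ (h x)) ⟩
    h x + sum-h′ + g x             ≡⟨ cong (_+ g x) (sym (sum-remove {i = x} h)) ⟩
    sum h + g x                    ∎
    where
    open ≤-Reasoning
    sum-g′ sum-h′ : ℕ
    sum-g′ = sum (removeAt g x)
    sum-h′ = sum (removeAt h x)

  𝟙 : Subset n → Fin n → ℕ
  𝟙 s v = if does (v ∈? s) then 1 else 0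

  ∣∣≡sum-𝟙 : (s : Subset n) → ∣ s ∣ ≡ sum (𝟙 s)
  ∣∣≡sum-𝟙 []            = refl
  ∣∣≡sum-𝟙 (inside  ∷ s) = cong suc (∣∣≡sum-𝟙 s)
  ∣∣≡sum-𝟙 (outside ∷ s) = ∣∣≡sum-𝟙 s

  𝟙-∩ : (s s′ : Subset n) (v : Fin n) → 𝟙 (s ∩ s′) v ≡ 𝟙 s v * 𝟙 s′ v
  𝟙-∩ (inside  ∷ s) (inside  ∷ s′) zero    = refl
  𝟙-∩ (inside  ∷ s) (outside ∷ s′) zero    = refl
  𝟙-∩ (outside ∷ s) (_       ∷ s′) zero    = refl
  𝟙-∩ (_       ∷ s) (_       ∷ s′) (suc v) = 𝟙-∩ s s′ v

  𝟙-∈ : {s : Subset n} {v : Fin n} → v ∈ₛ s → 𝟙 s v ≡ 1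
  𝟙-∈ {s = s} {v} v∈s rewrite dec-true (v ∈? s) v∈s = refl

  deg : List (Subset n) → Fin n → ℕ
  deg L v = length (filter (v ∈?_) L)

  deg-∷ : (f : Subset n) (L : List (Subset n)) (v : Fin n) → deg (f ∷ L) v ≡ 𝟙 f v + deg L v
  deg-∷ f L v with does (v ∈? f)
  ... | true  = refl
  ... | false = refl

  sum-deg : (S : Subset n) (L : List (Subset n)) →
    sum (λ v → 𝟙 S v * deg L v) ≡ sumₗ (map (λ f → ∣ f ∩ S ∣) L)
  sum-deg {n} S [] = trans (sum-cong-≗ (λ v → *-zeroʳ (𝟙 S v))) (sum-replicate-zero n)
  sum-deg S (f ∷ L) = begin
    sum (λ v → 𝟙 S v * deg (f ∷ L) v)
      ≡⟨ sum-cong-≗ split ⟩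
    sum (λ v → 𝟙 (f ∩ S) v + 𝟙 S v * deg L v)
      ≡⟨ ∑-distrib-+ (𝟙 (f ∩ S)) (λ v → 𝟙 S v * deg L v) ⟩
    sum (𝟙 (f ∩ S)) + sum (λ v → 𝟙 S v * deg L v)
      ≡⟨ cong₂ _+_ (sym (∣∣≡sum-𝟙 (f ∩ S))) (sum-deg S L) ⟩
    ∣ f ∩ S ∣ + sumₗ (map (λ f → ∣ f ∩ S ∣) L)   ∎
    where
    open ≡-Reasoning
    split : ∀ v → 𝟙 S v * deg (f ∷ L) v ≡ 𝟙 (f ∩ S) v + 𝟙 S v * deg L v
    split v = begin
      𝟙 S v * deg (f ∷ L) v             ≡⟨ cong (𝟙 S v *_) (deg-∷ f L v) ⟩
      𝟙 S v * (𝟙 f v + deg L v)         ≡⟨ *-distribˡ-+ (𝟙 S v) (𝟙 f v) (deg L v) ⟩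
      𝟙 S v * 𝟙 f v + 𝟙 S v * deg L v   ≡⟨ cong (_+ 𝟙 S v * deg L v) (trans (*-comm (𝟙 S v) (𝟙 f v)) (sym (𝟙-∩ f S v))) ⟩
      𝟙 (f ∩ S) v + 𝟙 S v * deg L v     ∎

  sum-deg-≤ : (S : Subset n) (L : List (Subset n)) {Δ : ℕ} → (∀ v → deg L v ≤ Δ) →
    sum (λ v → 𝟙 S v * deg L v) ≤ ∣ S ∣ * Δ
  sum-deg-≤ S L {Δ} deg≤Δ = begin
    sum (λ v → 𝟙 S v * deg L v)   ≤⟨ sum-mono (λ v → *-monoʳ-≤ (𝟙 S v) (deg≤Δ v)) ⟩
    sum (λ v → 𝟙 S v * Δ)         ≡⟨ sym (*-distribʳ-sum Δ (𝟙 S)) ⟩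
    sum (𝟙 S) * Δ                 ≡⟨ cong (_* Δ) (sym (∣∣≡sum-𝟙 S)) ⟩
    ∣ S ∣ * Δ                     ∎
    where open ≤-Reasoning

  -- If every vertex has degree at least δ and x ∈ S has degree Δ, then
  -- |S|·δ + Δ ≤ Σ_{v ∈ S} deg v + δ  (x contributes Δ instead of δ).
  sum-deg-≥ : (S : Subset n) (L : List (Subset n)) {x : Fin n} {Δ δ : ℕ} →
    x ∈ₛ S → deg L x ≡ Δ → (∀ v → δ ≤ deg L v) →
    ∣ S ∣ * δ + Δ ≤ sum (λ v → 𝟙 S v * deg L v) + δ
  sum-deg-≥ S L {x} {Δ} {δ} x∈S degx≡Δ δ≤deg = begin
    ∣ S ∣ * δ + Δ
      ≡⟨ cong₂ _+_ (trans (cong (_* δ) (∣∣≡sum-𝟙 S)) (*-distribʳ-sum δ (𝟙 S))) (sym weight-x) ⟩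
    sum (λ v → 𝟙 S v * δ) + 𝟙 S x * deg L x
      ≤⟨ sum-exchange (λ v → *-monoʳ-≤ (𝟙 S v) (δ≤deg v)) x ⟩
    sum (λ v → 𝟙 S v * deg L v) + 𝟙 S x * δ
      ≡⟨ cong (sum (λ v → 𝟙 S v * deg L v) +_) (trans (cong (_* δ) (𝟙-∈ x∈S)) (*-identityˡ δ)) ⟩
    sum (λ v → 𝟙 S v * deg L v) + δ   ∎
    where
    open ≤-Reasoning
    weight-x : 𝟙 S x * deg L x ≡ Δ
    weight-x = trans (cong (_* deg L x) (𝟙-∈ x∈S)) (trans (*-identityˡ (deg L x)) degx≡Δ)

  sumₗ-≥ : {A : Set} (g : A → ℕ) {t : ℕ} (L : List A) → (∀ f → f ∈ L → t ≤ g f) →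
    t * length L ≤ sumₗ (map g L)
  sumₗ-≥ g {t} []      t≤g = ≤-reflexive (*-zeroʳ t)
  sumₗ-≥ g {t} (f ∷ L) t≤g = begin
    t * suc (length L)        ≡⟨ *-suc t (length L) ⟩
    t + t * length L          ≤⟨ +-mono-≤ (t≤g f (here refl)) (sumₗ-≥ g L (λ f′ f′∈L → t≤g f′ (there f′∈L))) ⟩
    g f + sumₗ (map g L)      ∎
    where open ≤-Reasoning

  sumₗ-≥-pivot : {A : Set} (g : A → ℕ) {t : ℕ} {e : A} (L : List A) → e ∈ L →
    (∀ f → f ∈ L → t ≤ g f) → g e + t * length L ≤ sumₗ (map g L) + t
  sumₗ-≥-pivot g {t} {e} (e ∷ L) (here refl) t≤g = begin
    g e + t * suc (length L)   ≡⟨ cong (g e +_) (trans (*-suc t (length L)) (+-comm t _)) ⟩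
    g e + (t * length L + t)   ≤⟨ +-monoʳ-≤ (g e) (+-monoˡ-≤ t (sumₗ-≥ g L (λ f f∈L → t≤g f (there f∈L)))) ⟩
    g e + (sumₗ (map g L) + t) ≡⟨ sym (+-assoc (g e) _ t) ⟩
    g e + sumₗ (map g L) + t   ∎
    where open ≤-Reasoning
  sumₗ-≥-pivot g {t} {e} (f ∷ L) (there e∈L) t≤g = begin
    g e + t * suc (length L)   ≡⟨ cong (g e +_) (*-suc t (length L)) ⟩
    g e + (t + t * length L)   ≡⟨ x∙yz≈y∙xz (g e) t (t * length L) ⟩
    t + (g e + t * length L)   ≤⟨ +-mono-≤ (t≤g f (here refl)) (sumₗ-≥-pivot g L e∈L (λ f′ f′∈L → t≤g f′ (there f′∈L))) ⟩
    g f + (sumₗ (map g L) + t) ≡⟨ sym (+-assoc (g f) _ t) ⟩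
    g f + sumₗ (map g L) + t   ∎
    where open ≤-Reasoning

  Transversal : List (Subset n) → Subset n → Set
  Transversal L S = ∀ f → f ∈ L → ∣ f ∩ S ∣ ≡ 1

  nonempty : (s : Subset n) → ∣ s ∣ ≢ 0 → Nonempty s
  nonempty {n} s ∣s∣≢0 with nonempty? s
  ... | yes s≠∅ = s≠∅
  ... | no  s=∅ = contradiction (trans (cong ∣_∣ (Empty-unique s=∅)) (∣⊥∣≡0 n)) ∣s∣≢0

  transversal⇒cover : (H : Hypergraph n) (S : Subset n) → Transversal (edges H) S → IsCover H S
  transversal⇒cover H S S-trans f f∈E with nonempty (f ∩ S) (λ ∣f∩S∣≡0 → 1+n≢0 (trans (sym (S-trans f f∈E)) ∣f∩S∣≡0))
  ... | v , v∈f∩S with x∈p∩q⁻ f S v∈f∩S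
  ...   | v∈f , v∈S = v , v∈S , v∈f

  -- Each edge is counted once by the degrees along a transversal, so if a vertex x of
  -- the transversal has degree Δ and all degrees are ≥ δ, then |S|·δ + Δ ≤ |L| + δ.
  transversal-bound : (L : List (Subset n)) (S : Subset n) {x : Fin n} {Δ δ : ℕ} → Transversal L S →
    x ∈ₛ S → deg L x ≡ Δ → (∀ v → δ ≤ deg L v) → ∣ S ∣ * δ + Δ ≤ length L + δ
  transversal-bound L S {Δ = Δ} {δ} S-trans x∈S degx≡Δ δ≤deg = begin
    ∣ S ∣ * δ + Δ                             ≤⟨ sum-deg-≥ S L x∈S degx≡Δ δ≤deg ⟩
    sum (λ v → 𝟙 S v * deg L v) + δ           ≡⟨ cong (_+ δ) (trans (sum-deg S L) (sumₗ-1 L S-trans)) ⟩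
    length L + δ                              ∎
    where
    open ≤-Reasoning
    sumₗ-1 : ∀ L′ → Transversal L′ S → sumₗ (map (λ f → ∣ f ∩ S ∣) L′) ≡ length L′
    sumₗ-1 []       _  = refl
    sumₗ-1 (f ∷ L′) tr = cong₂ _+_ (tr f (here refl)) (sumₗ-1 L′ (λ f′ f′∈L′ → tr f′ (there f′∈L′)))

  edge-incidence-bound : (L : List (Subset n)) {e : Subset n} {r t Δ : ℕ} → e ∈ L →
    (∀ f → f ∈ L → ∣ f ∣ ≡ r) → (∀ f g → f ∈ L → g ∈ L → t ≤ ∣ f ∩ g ∣) → (∀ v → deg L v ≤ Δ) →
    r + t * length L ≤ r * Δ + t
  edge-incidence-bound L {e} {r} {t} {Δ} e∈L uniform intersecting deg≤Δ = begin
    r + t * length L                              ≡⟨ cong (_+ t * length L) (sym ∣e∩e∣≡r) ⟩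
    ∣ e ∩ e ∣ + t * length L                      ≤⟨ sumₗ-≥-pivot (λ f → ∣ f ∩ e ∣) L e∈L (λ f f∈L → intersecting f e f∈L e∈L) ⟩
    sumₗ (map (λ f → ∣ f ∩ e ∣) L) + t           ≡⟨ cong (_+ t) (sym (sum-deg e L)) ⟩
    sum (λ v → 𝟙 e v * deg L v) + t              ≤⟨ +-monoˡ-≤ t (sum-deg-≤ e L deg≤Δ) ⟩
    ∣ e ∣ * Δ + t                                 ≡⟨ cong (λ k → k * Δ + t) (uniform e e∈L) ⟩
    r * Δ + t                                     ∎
    where
    open ≤-Reasoning
    ∣e∩e∣≡r : ∣ e ∩ e ∣ ≡ r
    ∣e∩e∣≡r = trans (cong ∣_∣ (∩-idem e)) (uniform e e∈L)

  edge-of-positive-degree : (L : List (Subset n)) (v : Fin n) → 0 < deg L v → ∃[ e ] e ∈ L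
  edge-of-positive-degree (f ∷ L) v _ = f , here refl

  ∈-own-part : ∀ {r} (p : Fin n → Fin r) (x : Fin n) → x ∈ₛ partOf p (p x)
  ∈-own-part p x = lookup⇒[]= x _
    (trans (lookup∘tabulate _ x) (trans (isYes≗does (p x ≟ p x)) (dec-true (p x ≟ p x) refl)))

  combine-bounds : (r t Δ δ τ c m : ℕ) → τ ≤ c → c * δ + Δ ≤ m + δ → r + t * m ≤ r * Δ + t →
    t * δ * τ + t * Δ + r ≤ r * Δ + t + t * δ
  combine-bounds r t Δ δ τ c m τ≤c part-bound edge-bound = begin
    t * δ * τ + t * Δ + r     ≡⟨ factor-t t δ τ Δ r ⟩
    t * (τ * δ + Δ) + r       ≤⟨ +-monoˡ-≤ r (*-monoʳ-≤ t (+-monoˡ-≤ Δ (*-monoˡ-≤ δ τ≤c))) ⟩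
    t * (c * δ + Δ) + r       ≤⟨ +-monoˡ-≤ r (*-monoʳ-≤ t part-bound) ⟩
    t * (m + δ) + r           ≡⟨ expand-t t m δ r ⟩
    r + t * m + t * δ         ≤⟨ +-monoˡ-≤ (t * δ) edge-bound ⟩
    r * Δ + t + t * δ         ∎
    where
    open ≤-Reasoning
    factor-t : ∀ t δ τ Δ r → t * δ * τ + t * Δ + r ≡ t * (τ * δ + Δ) + r
    factor-t = solve-∀
    expand-t : ∀ t m δ r → t * (m + δ) + r ≡ r + t * m + t * δ
    expand-t = solve-∀

module RationalArithmetic where
  open import Data.Nat as ℕ using (ℕ; suc; NonZero)
  open import Data.Integer as ℤ using (ℤ; +_; +≤+; NonNegative) renaming (_-_ to _-ℤ_)
  open import Data.Integer.Properties using (pos-*; *-identityʳ; *-monoˡ-≤-nonNeg; +-monoˡ-≤)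
  open import Data.Integer.Tactic.RingSolver using (solve-∀)
  open import Data.Rational using (ℚ; _/_; _*_; _-_; -_; _≤_; toℚᵘ)
  open import Data.Rational.Properties using (toℚᵘ-fromℚᵘ; toℚᵘ-cancel-≤; toℚᵘ-homo-+; toℚᵘ-homo-*; toℚᵘ-homo‿-)
  open import Data.Rational.Unnormalised as ℚᵘ using (ℚᵘ; mkℚᵘ; *≤*; _≃_)
  open import Data.Rational.Unnormalised.Properties as ℚᵘ using (≤-respˡ-≃; ≤-respʳ-≃; ≃-sym; ≃-trans)
  open import Relation.Binary.PropositionalEquality

  -- Over ℤ, with δ ≥ 0: if tδτ + tΔ + r ≤ rΔ + t + tδ then, multiplying by δ and
  -- moving δ(tΔ + r) across, τ·δtδ ≤ (Δ-1)rδ - (Δ-δ-1)δt.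
  numerator-bound : (r t Δ δ τ : ℤ) → .{{NonNegative δ}} →
    t ℤ.* δ ℤ.* τ ℤ.+ t ℤ.* Δ ℤ.+ r ℤ.≤ r ℤ.* Δ ℤ.+ t ℤ.+ t ℤ.* δ →
    τ ℤ.* (δ ℤ.* t ℤ.* δ) ℤ.≤ ((Δ -ℤ + 1) ℤ.* r) ℤ.* δ ℤ.+ ℤ.- (Δ -ℤ δ -ℤ + 1) ℤ.* (δ ℤ.* t)
  numerator-bound r t Δ δ τ h =
    subst₂ ℤ._≤_ (sym (lhs-form r t Δ δ τ)) (sym (rhs-form r t Δ δ))
      (+-monoˡ-≤ (ℤ.- (δ ℤ.* (t ℤ.* Δ ℤ.+ r))) (*-monoˡ-≤-nonNeg δ h))
    where
    lhs-form : ∀ r t Δ δ τ → τ ℤ.* (δ ℤ.* t ℤ.* δ)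
      ≡ δ ℤ.* (t ℤ.* δ ℤ.* τ ℤ.+ t ℤ.* Δ ℤ.+ r) ℤ.+ ℤ.- (δ ℤ.* (t ℤ.* Δ ℤ.+ r))
    lhs-form = solve-∀
    rhs-form : ∀ r t Δ δ → ((Δ -ℤ + 1) ℤ.* r) ℤ.* δ ℤ.+ ℤ.- (Δ -ℤ δ -ℤ + 1) ℤ.* (δ ℤ.* t)
      ≡ δ ℤ.* (r ℤ.* Δ ℤ.+ t ℤ.+ t ℤ.* δ) ℤ.+ ℤ.- (δ ℤ.* (t ℤ.* Δ ℤ.+ r))
    rhs-form = solve-∀

  counting-ℤ : (r t Δ δ τ : ℕ) →
    t ℕ.* δ ℕ.* τ ℕ.+ t ℕ.* Δ ℕ.+ r ℕ.≤ r ℕ.* Δ ℕ.+ t ℕ.+ t ℕ.* δ →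
    + t ℤ.* + δ ℤ.* + τ ℤ.+ + t ℤ.* + Δ ℤ.+ + r ℤ.≤ + r ℤ.* + Δ ℤ.+ + t ℤ.+ + t ℤ.* + δ
  counting-ℤ r t Δ δ τ h = subst₂ ℤ._≤_
    (cong₂ (λ a b → a ℤ.+ b ℤ.+ + r) (trans (pos-* (t ℕ.* δ) τ) (cong (ℤ._* + τ) (pos-* t δ))) (pos-* t Δ))
    (cong₂ (λ a b → a ℤ.+ + t ℤ.+ b) (pos-* r Δ) (pos-* t δ))
    (+≤+ h)

  -- The bound as an unnormalised rational, for δ = 1 + d and t = 1 + t′.
  boundᵘ : (r t′ Δ d : ℕ) → ℚᵘ
  boundᵘ r t′ Δ d = (mkℚᵘ (+ Δ -ℤ + 1) d ℚᵘ.* mkℚᵘ (+ r) t′) ℚᵘ.- mkℚᵘ (+ Δ -ℤ + suc d -ℤ + 1) d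

  boundᵘ-≥ : (r t′ Δ d τ : ℕ) →
    suc t′ ℕ.* suc d ℕ.* τ ℕ.+ suc t′ ℕ.* Δ ℕ.+ r ℕ.≤ r ℕ.* Δ ℕ.+ suc t′ ℕ.+ suc t′ ℕ.* suc d →
    mkℚᵘ (+ τ) 0 ℚᵘ.≤ boundᵘ r t′ Δ d
  boundᵘ-≥ r t′ Δ d τ h = *≤* (subst₂ ℤ._≤_
    (cong (+ τ ℤ.*_) (sym (trans (pos-* (δ ℕ.* t) δ) (cong (ℤ._* + δ) (pos-* δ t)))))
    (trans (cong (λ k → (+ Δ -ℤ + 1) ℤ.* + r ℤ.* + δ ℤ.+ ℤ.- (+ Δ -ℤ + δ -ℤ + 1) ℤ.* k) (sym (pos-* δ t)))
           (sym (*-identityʳ _)))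
    (numerator-bound (+ r) (+ t) (+ Δ) (+ δ) (+ τ) (counting-ℤ r t Δ δ τ h)))
    where
    t δ : ℕ
    t = suc t′
    δ = suc d

  toℚᵘ-/ : (z : ℤ) (k : ℕ) → toℚᵘ (z / suc k) ≃ mkℚᵘ z k
  toℚᵘ-/ z k = toℚᵘ-fromℚᵘ (mkℚᵘ z k)

  bound≃boundᵘ : (r t′ Δ d : ℕ) →
    toℚᵘ ((((+ Δ) -ℤ (+ 1)) / suc d) * ((+ r) / suc t′) - ((((+ Δ) -ℤ (+ suc d)) -ℤ (+ 1)) / suc d))
      ≃ boundᵘ r t′ Δ d
  bound≃boundᵘ r t′ Δ d = ≃-trans (toℚᵘ-homo-+ (x * y) (- w))
    (ℚᵘ.+-cong (≃-trans (toℚᵘ-homo-* x y) (ℚᵘ.*-cong (toℚᵘ-/ (+ Δ -ℤ + 1) d) (toℚᵘ-/ (+ r) t′)))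
               (≃-trans (toℚᵘ-homo‿- w) (ℚᵘ.-‿cong (toℚᵘ-/ (+ Δ -ℤ + suc d -ℤ + 1) d))))
    where
    x y w : ℚ
    x = ((+ Δ) -ℤ (+ 1)) / suc d
    y = (+ r) / suc t′
    w = (((+ Δ) -ℤ (+ suc d)) -ℤ (+ 1)) / suc d

  rational-bound : (r t Δ δ τ : ℕ) → .{{_ : NonZero t}} → .{{_ : NonZero δ}} →
    t ℕ.* δ ℕ.* τ ℕ.+ t ℕ.* Δ ℕ.+ r ℕ.≤ r ℕ.* Δ ℕ.+ t ℕ.+ t ℕ.* δ →
    (+ τ / 1) ≤ ((((+ Δ) -ℤ (+ 1)) / δ) * ((+ r) / t)) - ((((+ Δ) -ℤ (+ δ)) -ℤ (+ 1)) / δ)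
  rational-bound r (suc t′) Δ (suc d) τ h = toℚᵘ-cancel-≤
    (≤-respʳ-≃ (≃-sym (bound≃boundᵘ r t′ Δ d))
      (≤-respˡ-≃ (≃-sym (toℚᵘ-/ (+ τ) 0)) (boundᵘ-≥ r t′ Δ d τ h)))

open import Data.Nat using (ℕ; NonZero)
open import Data.Integer using (+_) renaming (_-_ to _-ℤ_)
open import Data.Rational using (ℚ; _/_; _*_; _-_; _≤_)
import Data.Nat as ℕ
open import Data.Fin.Subset using (Subset; ∣_∣)
open import Data.List using (length)
open import Data.Product using (_,_; proj₂)
open import Relation.Binary.PropositionalEquality using (subst; sym)

open Counting
open RationalArithmetic using (rational-bound)

lemma3p3 : ∀ {n} (r t Δ δ : ℕ) (H : Hypergraph n) → .{{_ : NonZero t}} → .{{_ : NonZero δ}} →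
    IsRTGraph r t H → MaxDegree H Δ → MinDegree H δ →
    ∀ τ → IsCoverNumber H τ →
    (+ τ / 1) ≤ ((((+ Δ) -ℤ (+ 1)) / δ) * ((+ r) / t)) - ((((+ Δ) -ℤ (+ δ)) -ℤ (+ 1)) / δ)
lemma3p3 r t Δ δ H (uniform , (p , partite) , intersecting) ((x , degx≡Δ) , deg≤Δ) ((y , degy≡δ) , δ≤deg)
         τ (_ , τ-minimal) =
  rational-bound r t Δ δ τ
    (combine-bounds r t Δ δ τ ∣ P ∣ (length (edges H)) τ≤∣P∣ part-bound edge-bound)
  where
  P : Subset _
  P = partOf p (p x)

  P-transversal : Transversal (edges H) P
  P-transversal f f∈E = partite f f∈E (p x)

  τ≤∣P∣ : τ ℕ.≤ ∣ P ∣
  τ≤∣P∣ = τ-minimal P (transversal⇒cover H P P-transversal)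

  part-bound : ∣ P ∣ ℕ.* δ ℕ.+ Δ ℕ.≤ length (edges H) ℕ.+ δ
  part-bound = transversal-bound (edges H) P P-transversal (∈-own-part p x) degx≡Δ δ≤deg

  edge-bound : r ℕ.+ t ℕ.* length (edges H) ℕ.≤ r ℕ.* Δ ℕ.+ t
  edge-bound = edge-incidence-bound (edges H) (proj₂ (edge-of-positive-degree (edges H) y y-has-degree))
    uniform intersecting deg≤Δ
    where
    y-has-degree : 0 ℕ.< degree H y
    y-has-degree = subst (0 ℕ.<_) (sym degy≡δ) (ℕ.>-nonZero⁻¹ δ)
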